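{- The category $\mathbf{UHGraph}$ has all finite colimits, and they are computed pointwise: for every finite diagram $D\colon\mathcal J\to\mathbf{UHGraph}$ there is a colimit $G_0=(V_0,E_0,\mathrm{ends})$ with coprojections $(c_i,d_i)\colon D(i)\to G_0$ such that $V_0$ with the maps $c_i$ is a colimit in $\mathbf{Set}$ of the diagram of vertex sets of $D$, and $E_0$ with the maps $d_i$ is a colimit in $\mathbf{Set}$ of the diagram of edge sets of $D$.
   Context: A hypergraph $G=(V,E,\mathrm{ends})$ consists of finite sets $V$ (vertices), $E$ (edges) and a function $\mathrm{ends}\colon E\to\mathcal P(V)$. A hypergraph homomorphism $\alpha\colon G\to H$ is a pair of functions $\alpha_V\colon V_G\to V_H$, $\alpha_E\colon E_G\to E_H$ with $\mathrm{ends}_H(\alpha_E(e))=\alpha_V(\mathrm{ends}_G(e))$ for all $e\in E_G$ (image of a subset). $\mathbf{UHGraph}$ is the category of hypergraphs and hypergraph homomorphisms, with componentwise composition and identities. -}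

module Defs where

open import Data.Nat using (ℕ)
open import Data.Fin using (Fin)
open import Data.Fin.Subset using (Subset; _∈_)
open import Data.Product using (Σ; ∃; _×_; _,_)
open import Function using (_∘_; _⇔_)
open import Relation.Binary.PropositionalEquality using (_≡_; _≗_)

-- Finite hypergraphs.  A finite set is modelled as Fin n; a subset of
-- the vertex set as  Subset nV  (a characteristic vector).

record HGraph : Set where
  field
    nV   : ℕ
    nE   : ℕ
    ends : Fin nE → Subset nV
open HGraph public

IsImage : ∀ {m n} → (Fin m → Fin n) → Subset m → Subset n → Set
IsImage f S T = ∀ w → (w ∈ T) ⇔ (Σ _ λ v → v ∈ S × f v ≡ w)

record HHom (G H : HGraph) : Set where
  field
    αV  : Fin (nV G) → Fin (nV H)
    αE  : Fin (nE G) → Fin (nE H)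
    hom : ∀ e → IsImage αV (ends G e) (ends H (αE e))
open HHom public

idV : ∀ {n} → Fin n → Fin n
idV x = x

_≈H_ : ∀ {G H} → HHom G H → HHom G H → Set
α ≈H β = (αV α ≗ αV β) × (αE α ≗ αE β)

record FinCat : Set where
  field
    nObj : ℕ
    nHom : Fin nObj → Fin nObj → ℕ
  Obj : Set
  Obj = Fin nObj
  Hom : Obj → Obj → Set
  Hom i j = Fin (nHom i j)
  field
    idJ   : ∀ i → Hom i i
    _∘J_  : ∀ {i j k} → Hom j k → Hom i j → Hom i k
    idˡ   : ∀ {i j} (f : Hom i j) → (idJ j ∘J f) ≡ f
    idʳ   : ∀ {i j} (f : Hom i j) → (f ∘J idJ i) ≡ f
    assoc : ∀ {i j k l} (h : Hom k l) (g : Hom j k) (f : Hom i j) →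
            ((h ∘J g) ∘J f) ≡ (h ∘J (g ∘J f))
open FinCat public

record Diagram (J : FinCat) : Set where
  field
    obj   : Obj J → HGraph
    map   : ∀ {i j} → Hom J i j → HHom (obj i) (obj j)
    mapId : ∀ i → (αV (map (idJ J i)) ≗ idV) × (αE (map (idJ J i)) ≗ idV)
    mapComp : ∀ {i j k} (g : Hom J j k) (f : Hom J i j) →
      (αV (map (_∘J_ J g f)) ≗ (αV (map g) ∘ αV (map f))) ×
      (αE (map (_∘J_ J g f)) ≗ (αE (map g) ∘ αE (map f)))
open Diagram public

SetCocone : (J : FinCat) (F : Obj J → Set)
            (Fmap : ∀ {i j} → Hom J i j → F i → F j)
            (X : Set) (c : ∀ i → F i → X) → Set
SetCocone J F Fmap X c = ∀ {i j} (f : Hom J i j) → (c j ∘ Fmap f) ≗ c i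

IsSetColimit : (J : FinCat) (F : Obj J → Set)
               (Fmap : ∀ {i j} → Hom J i j → F i → F j)
               (X : Set) (c : ∀ i → F i → X) → Set₁
IsSetColimit J F Fmap X c =
  SetCocone J F Fmap X c ×
  (∀ (Y : Set) (y : ∀ i → F i → Y) → SetCocone J F Fmap Y y →
     Σ (X → Y) λ u → (∀ i → (u ∘ c i) ≗ y i) ×
       (∀ (u' : X → Y) → (∀ i → (u' ∘ c i) ≗ y i) → u' ≗ u))

VDiag : ∀ {J} (D : Diagram J) → Obj J → Set
VDiag D i = Fin (nV (obj D i))

VMap : ∀ {J} (D : Diagram J) {i j : Obj J} → Hom J i j → VDiag D i → VDiag D j
VMap D f = αV (map D f)

EDiag : ∀ {J} (D : Diagram J) → Obj J → Set
EDiag D i = Fin (nE (obj D i))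

EMap : ∀ {J} (D : Diagram J) {i j : Obj J} → Hom J i j → EDiag D i → EDiag D j
EMap D f = αE (map D f)

HCocone : ∀ {J} (D : Diagram J) (G : HGraph) (κ : ∀ i → HHom (obj D i) G) → Set
HCocone {J} D G κ = ∀ {i j} (f : Hom J i j) →
  ((αV (κ j) ∘ αV (map D f)) ≗ αV (κ i)) × ((αE (κ j) ∘ αE (map D f)) ≗ αE (κ i))

Factors : ∀ {J} (D : Diagram J) {G H : HGraph} (κ : ∀ i → HHom (obj D i) G)
          (λ' : ∀ i → HHom (obj D i) H) (u : HHom G H) → Set
Factors D κ λ' u = ∀ i → ((αV u ∘ αV (κ i)) ≗ αV (λ' i)) × ((αE u ∘ αE (κ i)) ≗ αE (λ' i))

IsHColimit : ∀ {J} (D : Diagram J) (G : HGraph) (κ : ∀ i → HHom (obj D i) G) → Set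
IsHColimit D G κ =
  HCocone D G κ ×
  (∀ (H : HGraph) (λ' : ∀ i → HHom (obj D i) H) → HCocone D H λ' →
     Σ (HHom G H) λ u → Factors D κ λ' u ×
       (∀ (u' : HHom G H) → Factors D κ λ' u' → u' ≈H u))

-- A finite colimit of sets is the disjoint union of the objects modulo the
-- equivalence generated by the pairs (F f a, a); constructively we realise it
-- as Fin m by merging two points of a finite set at a time, keeping a section
-- of the quotient map. Gluing the vertex and edge colimits, the ends of an
-- edge of the colimit are the image of the ends of any of its preimages; this
-- is well defined because hypergraph homomorphisms transport ends to images,
-- and images compose. The maps induced on vertices and edges by a cocone of
-- hypergraphs then form a homomorphism, so both universal properties transfer.
module Submission where

open import Defs
open import Data.Bool using (Bool; true)
open import Data.Bool.Properties using (T-≡)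
open import Data.Empty using (⊥-elim)
open import Data.Fin using (Fin; zero; suc; punchIn; punchOut; _≟_)
open import Data.Fin.Properties
  using (+↔⊎; any?; punchInᵢ≢i; punchIn-punchOut; punchOut-punchIn; punchOut-cong)
open import Data.Fin.Subset using (Subset; _∈_)
open import Data.Fin.Subset.Properties using (_∈?_; ⊆-antisym)
open import Data.List using (List; []; _∷_; concat; tabulate)
open import Data.List.Relation.Unary.All as All using (All; []; _∷_)
open import Data.List.Relation.Unary.All.Properties using (concat⁺; concat⁻; tabulate⁺; tabulate⁻)
open import Data.Nat using (ℕ; zero; suc; _+_)
open import Data.Product using (Σ; _×_; _,_; proj₁; proj₂; curry)
open import Data.Sum using (_⊎_; inj₁; inj₂)
open import Data.Sum.Function.Propositional using (_⊎-↔_)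
open import Data.Vec as Vec using ()
open import Data.Vec.Properties using ([]=⇒lookup; lookup⇒[]=; lookup∘tabulate)
open import Function using (_∘_; id; _⇔_; _↔_; mk⇔; mk↔ₛ′; Inverse; Equivalence)
open import Function.Properties.Inverse using (↔-refl; ↔-sym; ↔-trans)
open import Relation.Nullary using (yes; no; isYes)
open import Relation.Nullary.Decidable using (toWitness; fromWitness; _×-dec_)
open import Relation.Binary.PropositionalEquality

⋃ : ∀ {B : Set} {k} → (Fin k → List B) → List B
⋃ f = concat (tabulate f)

module _ {B : Set} {P : B → Set} where

  All-⋃⁺ : ∀ {k} {f : Fin k → List B} → (∀ i → All P (f i)) → All P (⋃ f)
  All-⋃⁺ = concat⁺ ∘ tabulate⁺

  All-⋃⁻ : ∀ {k} {f : Fin k → List B} → All P (⋃ f) → ∀ i → All P (f i)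
  All-⋃⁻ = tabulate⁻ ∘ concat⁻

∑ : (k : ℕ) → (Fin k → ℕ) → ℕ
∑ zero    n = 0
∑ (suc k) n = n zero + ∑ k (n ∘ suc)

Σ-Fin-suc↔ : ∀ {k} {P : Fin (suc k) → Set} → Σ (Fin (suc k)) P ↔ (P zero ⊎ Σ (Fin k) (P ∘ suc))
Σ-Fin-suc↔ {k} {P} = mk↔ₛ′ to from to∘from from∘to
  where
  to : Σ (Fin (suc k)) P → P zero ⊎ Σ (Fin k) (P ∘ suc)
  to (zero  , p) = inj₁ p
  to (suc i , p) = inj₂ (i , p)
  from : P zero ⊎ Σ (Fin k) (P ∘ suc) → Σ (Fin (suc k)) P
  from (inj₁ p)       = zero , p
  from (inj₂ (i , p)) = suc i , p
  to∘from : ∀ x → to (from x) ≡ x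
  to∘from (inj₁ p) = refl
  to∘from (inj₂ _) = refl
  from∘to : ∀ x → from (to x) ≡ x
  from∘to (zero  , _) = refl
  from∘to (suc _ , _) = refl

Σ-Fin↔Fin-∑ : ∀ k (n : Fin k → ℕ) → Σ (Fin k) (Fin ∘ n) ↔ Fin (∑ k n)
Σ-Fin↔Fin-∑ zero    n = mk↔ₛ′ (λ ()) (λ ()) (λ ()) (λ ())
Σ-Fin↔Fin-∑ (suc k) n =
  ↔-trans Σ-Fin-suc↔ (↔-trans (↔-refl ⊎-↔ Σ-Fin↔Fin-∑ k (n ∘ suc)) (↔-sym +↔⊎))

Coequalizes : ∀ {A Y : Set} → List (A × A) → (A → Y) → Set
Coequalizes R g = All (λ (x , y) → g x ≡ g y) R

-- Fin size is the quotient of A by the equivalence relation generated by R.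
record FinQuotient (A : Set) (R : List (A × A)) : Set₁ where
  field
    size              : ℕ
    class             : A → Fin size
    rep               : Fin size → A
    class-rep         : ∀ k → class (rep k) ≡ k
    class-coequalizes : Coequalizes R class
    rep-class         : ∀ {Y : Set} (g : A → Y) → Coequalizes R g → ∀ x → g (rep (class x)) ≡ g x

discreteQuotient : ∀ {A n} → A ↔ Fin n → FinQuotient A []
discreteQuotient A↔Fin = record
  { size = _ ; class = to ; rep = from ; class-rep = strictlyInverseˡ
  ; class-coequalizes = [] ; rep-class = λ g _ x → cong g (strictlyInverseʳ x) }
  where open Inverse A↔Fin

mergeDistinct : ∀ {m} {a b : Fin (suc m)} → a ≢ b → FinQuotient (Fin (suc m)) ((a , b) ∷ [])
mergeDistinct {m} {a} {b} a≢b = record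
  { size = m ; class = class ; rep = punchIn b ; class-rep = class-rep
  ; class-coequalizes = class-ab ∷ [] ; rep-class = rep-class }
  where
  -- b is sent to the class of a, every other point keeps its own class
  class : Fin (suc m) → Fin m
  class c with c ≟ b
  ... | yes _  = punchOut (a≢b ∘ sym)
  ... | no c≢b = punchOut (c≢b ∘ sym)

  class-rep : ∀ k → class (punchIn b k) ≡ k
  class-rep k with punchIn b k ≟ b
  ... | yes eq = ⊥-elim (punchInᵢ≢i b k eq)
  ... | no _   = trans (punchOut-cong b refl) (punchOut-punchIn b)

  class-ab : class a ≡ class b
  class-ab with a ≟ b | b ≟ b
  ... | yes a≡b | _      = ⊥-elim (a≢b a≡b)
  ... | no _    | no b≢b = ⊥-elim (b≢b refl)
  ... | no _    | yes _  = punchOut-cong b refl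

  rep-class : ∀ {Y : Set} (g : Fin (suc m) → Y) → Coequalizes ((a , b) ∷ []) g →
              ∀ c → g (punchIn b (class c)) ≡ g c
  rep-class g (ga≡gb ∷ []) c with c ≟ b
  ... | yes refl = trans (cong g (punchIn-punchOut _)) ga≡gb
  ... | no _     = cong g (punchIn-punchOut _)

merge : ∀ {m} (a b : Fin m) → FinQuotient (Fin m) ((a , b) ∷ [])
merge {suc m} a b with a ≟ b
... | yes refl = record
  { size = suc m ; class = id ; rep = id ; class-rep = λ _ → refl
  ; class-coequalizes = refl ∷ [] ; rep-class = λ _ _ _ → refl }
... | no a≢b   = mergeDistinct a≢b

refine : ∀ {A R} {x y : A} (Q : FinQuotient A R) →
         let open FinQuotient Q in
         FinQuotient (Fin size) ((class x , class y) ∷ []) → FinQuotient A ((x , y) ∷ R)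
refine {A} {R} {x} {y} Q Q′ = record
  { size = Q′.size ; class = Q′.class ∘ Q.class ; rep = Q.rep ∘ Q′.rep
  ; class-rep = λ k → trans (cong Q′.class (Q.class-rep (Q′.rep k))) (Q′.class-rep k)
  ; class-coequalizes = All.head Q′.class-coequalizes ∷ All.map (cong Q′.class) Q.class-coequalizes
  ; rep-class = rep-class }
  where
  module Q  = FinQuotient Q
  module Q′ = FinQuotient Q′

  rep-class : ∀ {Y : Set} (g : A → Y) → Coequalizes ((x , y) ∷ R) g →
              ∀ z → g (Q.rep (Q′.rep (Q′.class (Q.class z)))) ≡ g z
  rep-class g (gx≡gy ∷ gR) z = begin
    g (Q.rep (Q′.rep (Q′.class (Q.class z)))) ≡⟨ Q′.rep-class (g ∘ Q.rep) (g-rep-xy ∷ []) (Q.class z) ⟩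
    g (Q.rep (Q.class z))                      ≡⟨ Q.rep-class g gR z ⟩
    g z                                        ∎
    where
    open ≡-Reasoning
    g-rep-xy : g (Q.rep (Q.class x)) ≡ g (Q.rep (Q.class y))
    g-rep-xy = trans (Q.rep-class g gR x) (trans gx≡gy (sym (Q.rep-class g gR y)))

finQuotient : ∀ {A n} → A ↔ Fin n → (R : List (A × A)) → FinQuotient A R
finQuotient A↔Fin []            = discreteQuotient A↔Fin
finQuotient A↔Fin ((x , y) ∷ R) = refine Q (merge (class x) (class y))
  where
  Q = finQuotient A↔Fin R
  open FinQuotient Q

module FinSetColimit (J : FinCat) (n : Obj J → ℕ)
                     (Fmap : ∀ {i j} → Hom J i j → Fin (n i) → Fin (n j)) where

  Elem : Set
  Elem = Σ (Obj J) (Fin ∘ n)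

  coconeRelation : List (Elem × Elem)
  coconeRelation =
    ⋃ λ i → ⋃ λ j → ⋃ λ (f : Hom J i j) → tabulate λ a → (j , Fmap f a) , (i , a)

  module _ {Y : Set} {g : Elem → Y} where

    cocone⇒coequalizes : SetCocone J (Fin ∘ n) Fmap Y (curry g) → Coequalizes coconeRelation g
    cocone⇒coequalizes c = All-⋃⁺ λ i → All-⋃⁺ λ j → All-⋃⁺ λ f → tabulate⁺ (c {i} {j} f)

    coequalizes⇒cocone : Coequalizes coconeRelation g → SetCocone J (Fin ∘ n) Fmap Y (curry g)
    coequalizes⇒cocone eq {i} {j} f = tabulate⁻ (All-⋃⁻ (All-⋃⁻ (All-⋃⁻ eq i) j) f)

  open FinQuotient (finQuotient (Σ-Fin↔Fin-∑ (nObj J) n) coconeRelation) public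

  ι : ∀ i → Fin (n i) → Fin size
  ι = curry class

  ι-cocone : SetCocone J (Fin ∘ n) Fmap (Fin size) ι
  ι-cocone = coequalizes⇒cocone class-coequalizes

  module _ {Y : Set} (y : ∀ i → Fin (n i) → Y) (cy : SetCocone J (Fin ∘ n) Fmap Y y) where

    induced : Fin size → Y
    induced k = y (proj₁ (rep k)) (proj₂ (rep k))

    induced-factors : ∀ i → (induced ∘ ι i) ≗ y i
    induced-factors i a = rep-class (λ (i , a) → y i a) (cocone⇒coequalizes cy) (i , a)

    induced-unique : ∀ (u : Fin size → Y) → (∀ i → (u ∘ ι i) ≗ y i) → u ≗ induced
    induced-unique u factors k = trans (cong u (sym (class-rep k))) (factors _ _)

  isSetColimit : IsSetColimit J (Fin ∘ n) Fmap (Fin size) ι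
  isSetColimit = ι-cocone , λ Y y cy → induced y cy , induced-factors y cy , induced-unique y cy

module _ {m n : ℕ} where

  ∈-tabulate⇔ : ∀ {p : Fin n → Bool} {w} → w ∈ Vec.tabulate p ⇔ p w ≡ true
  ∈-tabulate⇔ {p} {w} = mk⇔
    (λ w∈ → trans (sym (lookup∘tabulate p w)) ([]=⇒lookup w∈))
    (λ pw → lookup⇒[]= w _ (trans (lookup∘tabulate p w) pw))

  image : (Fin m → Fin n) → Subset m → Subset n
  image f S = Vec.tabulate λ w → isYes (any? λ v → (v ∈? S) ×-dec (f v ≟ w))

  image-isImage : ∀ f S → IsImage f S (image f S)
  image-isImage f S w = mk⇔
    (λ w∈ → toWitness (Equivalence.from T-≡ (Equivalence.to ∈-tabulate⇔ w∈)))
    (λ v∈ → Equivalence.from ∈-tabulate⇔ (Equivalence.to T-≡ (fromWitness v∈)))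

  IsImage-unique : ∀ {f : Fin m → Fin n} {S T T′} → IsImage f S T → IsImage f S T′ → T ≡ T′
  IsImage-unique T-img T′-img = ⊆-antisym
    (λ w∈T → Equivalence.from (T′-img _) (Equivalence.to (T-img _) w∈T))
    (λ w∈T′ → Equivalence.from (T-img _) (Equivalence.to (T′-img _) w∈T′))

  IsImage-resp-≗ : ∀ {f g : Fin m → Fin n} {S T} → f ≗ g → IsImage f S T → IsImage g S T
  IsImage-resp-≗ f≗g T-img w = mk⇔
    (λ w∈T → let (v , v∈S , fv≡w) = Equivalence.to (T-img w) w∈T in v , v∈S , trans (sym (f≗g v)) fv≡w)
    (λ (v , v∈S , gv≡w) → Equivalence.from (T-img w) (v , v∈S , trans (f≗g v) gv≡w))

IsImage-cancelʳ : ∀ {m n k} {f : Fin m → Fin n} {g : Fin n → Fin k} {S T U} →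
                  IsImage f S T → IsImage (g ∘ f) S U → IsImage g T U
IsImage-cancelʳ {f = f} {g} T-img U-img w = mk⇔
  (λ w∈U → let (v , v∈S , gfv≡w) = Equivalence.to (U-img w) w∈U in
           f v , Equivalence.from (T-img (f v)) (v , v∈S , refl) , gfv≡w)
  (λ (t , t∈T , gt≡w) → let (v , v∈S , fv≡t) = Equivalence.to (T-img t) t∈T in
           Equivalence.from (U-img w) (v , v∈S , trans (cong g fv≡t) gt≡w))

module HGraphColimit {J : FinCat} (D : Diagram J) where

  module V = FinSetColimit J (nV ∘ obj D) (VMap D)
  module E = FinSetColimit J (nE ∘ obj D) (EMap D)

  endsImage : E.Elem → Subset V.size
  endsImage (i , e) = image (V.ι i) (ends (obj D i) e)

  endsImage-cocone : SetCocone J (EDiag D) (EMap D) (Subset V.size) (curry endsImage)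
  endsImage-cocone {i} {j} f e = IsImage-unique (image-isImage (V.ι j) _)
    (IsImage-cancelʳ (hom (map D f) e)
      (IsImage-resp-≗ (sym ∘ V.ι-cocone f) (image-isImage (V.ι i) (ends (obj D i) e))))

  G₀ : HGraph
  G₀ = record { nV = V.size ; nE = E.size ; ends = endsImage ∘ E.rep }

  ends-ι : ∀ i e → ends G₀ (E.ι i e) ≡ endsImage (i , e)
  ends-ι i e = E.rep-class endsImage (E.cocone⇒coequalizes endsImage-cocone) (i , e)

  κ : ∀ i → HHom (obj D i) G₀
  κ i = record
    { αV = V.ι i ; αE = E.ι i
    ; hom = λ e → subst (IsImage (V.ι i) _) (sym (ends-ι i e)) (image-isImage (V.ι i) _) }

  module _ (H : HGraph) (λ′ : ∀ i → HHom (obj D i) H) (cλ : HCocone D H λ′) where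

    uV : Fin V.size → Fin (nV H)
    uV = V.induced (αV ∘ λ′) (proj₁ ∘ cλ)
    uE : Fin E.size → Fin (nE H)
    uE = E.induced (αE ∘ λ′) (proj₂ ∘ cλ)

    induced-hom-ι : ∀ i e → IsImage uV (ends G₀ (E.ι i e)) (ends H (uE (E.ι i e)))
    induced-hom-ι i e =
      subst₂ (λ S T → IsImage uV S (ends H T)) (sym (ends-ι i e))
             (sym (E.induced-factors (αE ∘ λ′) (proj₂ ∘ cλ) i e))
        (IsImage-cancelʳ (image-isImage (V.ι i) _)
          (IsImage-resp-≗ (sym ∘ V.induced-factors (αV ∘ λ′) (proj₁ ∘ cλ) i) (hom (λ′ i) e)))

    induced : HHom G₀ H
    induced = record
      { αV = uV ; αE = uE
      ; hom = λ k → subst (λ k → IsImage uV (ends G₀ k) (ends H (uE k))) (E.class-rep k)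
                          (induced-hom-ι (proj₁ (E.rep k)) (proj₂ (E.rep k))) }

  isHColimit : IsHColimit D G₀ κ
  isHColimit = (λ f → V.ι-cocone f , E.ι-cocone f) , λ H λ′ cλ →
    induced H λ′ cλ ,
    (λ i → V.induced-factors (αV ∘ λ′) (proj₁ ∘ cλ) i , E.induced-factors (αE ∘ λ′) (proj₂ ∘ cλ) i) ,
    (λ u factors → V.induced-unique (αV ∘ λ′) (proj₁ ∘ cλ) (αV u) (proj₁ ∘ factors)
                 , E.induced-unique (αE ∘ λ′) (proj₂ ∘ cλ) (αE u) (proj₂ ∘ factors))

proposition3p21 : (J : FinCat) (D : Diagram J) →
    Σ HGraph λ G₀ → Σ (∀ i → HHom (obj D i) G₀) λ κ →
      IsHColimit D G₀ κ ×
      IsSetColimit J (VDiag D) (VMap D) (Fin (nV G₀)) (λ i → αV (κ i)) ×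
      IsSetColimit J (EDiag D) (EMap D) (Fin (nE G₀)) (λ i → αE (κ i))
proposition3p21 J D = G₀ , κ , isHColimit , V.isSetColimit , E.isSetColimit
  where open HGraphColimit D
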